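{- Let $G$ be a simple graph with $n$ vertices and minimum degree at least three, and let $F$ be a linear forest subgraph of $G$ with at most one edge. Suppose that the length of the longest cycle of $G$ containing $F$ is at least $n-\sqrt{n-1}+1$. Then every longest cycle of $G$ containing $F$ has a chord.
   Context: A linear forest is a graph each of whose components is a path; a linear forest with at most one edge thus consists of isolated vertices together with possibly one edge. A cycle contains $F$ if it passes through all vertices and all edges of $F$; a longest cycle containing $F$ is one of maximum length among all cycles of $G$ containing $F$. A chord of a cycle $C$ in $G$ is an edge of $G$ joining two vertices of $C$ that are not consecutive on $C$. -}

module Defs where

open import Data.Nat using (ℕ; zero; suc; _≤_)
open import Data.Fin using (Fin; toℕ)
open import Data.Fin.Subset using (Subset; _∈_; ∣_∣)
open import Data.Bool using (Bool; T)
open import Data.Vec using (tabulate)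
open import Data.Maybe using (Maybe; just; nothing)
open import Data.Product using (Σ; ∃; ∃-syntax; _×_; _,_)
open import Data.Sum using (_⊎_)
open import Data.Unit using (⊤)
open import Relation.Nullary using (¬_)
open import Relation.Binary.PropositionalEquality using (_≡_)
open import Function.Definitions using (Injective)

record SimpleGraph (n : ℕ) : Set where
  field
    adj     : Fin n → Fin n → Bool
    symm    : ∀ u v → adj u v ≡ adj v u
    irrefl  : ∀ v → ¬ T (adj v v)
open SimpleGraph public

degree : ∀ {n} → SimpleGraph n → Fin n → ℕ
degree G v = ∣ tabulate (adj G v) ∣

-- Subgraph F of G with at most one edge: a vertex set and optionally one
-- edge of G whose endpoints lie in the vertex set.  (Any such graph is a
-- linear forest: isolated vertices plus possibly one edge.)
EdgeIn : ∀ {n} → SimpleGraph n → Subset n → Maybe (Fin n × Fin n) → Set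
EdgeIn G S nothing = ⊤
EdgeIn G S (just (a , b)) = T (adj G a b) × (a ∈ S) × (b ∈ S)

record LinearForest≤1 {n : ℕ} (G : SimpleGraph n) : Set where
  field
    verts   : Subset n
    edge    : Maybe (Fin n × Fin n)
    edge-ok : EdgeIn G verts edge
open LinearForest≤1 public

Consec : ∀ {k} → Fin k → Fin k → Set
Consec {k} i j = (suc (toℕ i) ≡ toℕ j) ⊎ ((suc (toℕ i) ≡ k) × (toℕ j ≡ 0))

record Cycle {n : ℕ} (G : SimpleGraph n) : Set where
  field
    len      : ℕ
    len≥3    : 3 ≤ len
    vtx      : Fin len → Fin n
    distinct : Injective _≡_ _≡_ vtx
    edges    : ∀ i j → Consec i j → T (adj G (vtx i) (vtx j))
open Cycle public

CycleEdge : ∀ {n} {G : SimpleGraph n} → Cycle G → Fin n → Fin n → Set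
CycleEdge C a b = ∃[ i ] ∃[ j ] Consec i j
  × ((vtx C i ≡ a × vtx C j ≡ b) ⊎ (vtx C i ≡ b × vtx C j ≡ a))

EdgeOnCycle : ∀ {n} {G : SimpleGraph n} → Cycle G → Maybe (Fin n × Fin n) → Set
EdgeOnCycle C nothing = ⊤
EdgeOnCycle C (just (a , b)) = CycleEdge C a b

Contains : ∀ {n} {G : SimpleGraph n} → Cycle G → LinearForest≤1 G → Set
Contains C F = (∀ v → v ∈ verts F → ∃[ i ] vtx C i ≡ v) × EdgeOnCycle C (edge F)

IsLongestContaining : ∀ {n} {G : SimpleGraph n} → LinearForest≤1 G → Cycle G → Set
IsLongestContaining {G = G} F C =
  Contains C F × ((D : Cycle G) → Contains D F → len D ≤ len C)

HasChord : ∀ {n} {G : SimpleGraph n} → Cycle G → Set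
HasChord {G = G} C = ∃[ i ] ∃[ j ] ¬ (i ≡ j) × ¬ Consec i j × ¬ Consec j i
  × T (adj G (vtx C i) (vtx C j))

-- Suppose C is a chordless longest cycle through F, of length k, and let c be the
-- number of vertices off C. As δ ≥ 3 and C has no chord, every vertex C[ t ] has a
-- neighbour outer t off C, so c ≥ 1. Take two positions t ≠ t′ whose vertices are not
-- ends of the edge of F, and suppose outer t = outer t′ = h and outer (t+1) =
-- outer (t′+1) = h′. If h = h′, inserting h into the edge C[ t ] C[ t+1 ] gives a
-- longer cycle through F; otherwise replacing the edges C[ t ] C[ t+1 ] and
-- C[ t′ ] C[ t′+1 ] by the paths through h and h′ does. So at least k − 2 positions
-- carry distinct pairs of outside vertices, k ≤ c² + 2, and with k + c ≤ n this
-- forces (n + 1 − k)² > n − 1.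
module Submission where

open import Defs
open import Data.Nat using (ℕ; zero; suc; _≤_; _<_; _+_; _∸_; _^_; _*_; z≤n; s≤s; s≤s⁻¹; NonZero; >-nonZero; >-nonZero⁻¹; _%_)
open import Data.Nat.Properties
open import Data.Nat.DivMod using (_mod_; m%n<n; m<n⇒m%n≡m; %-distribˡ-+; n%n≡0; m%n%n≡m%n; [m+n]%n≡m%n)
open import Data.Nat.Tactic.RingSolver using (solve-∀)
open import Data.Fin using (Fin; toℕ; fromℕ<; combine) renaming (zero to fzero; suc to fsuc)
open import Data.Fin.Properties using (nonZeroIndex; toℕ-injective; toℕ-fromℕ<; toℕ<n; any?; injective⇒≤; combine-injective) renaming (_≟_ to _≟ᶠ_; suc-injective to fsuc-injective)
open import Data.Fin.Subset using (Subset; _∈_; ∣_∣; ⁅_⁆; _∪_; _⊆_; inside; outside)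
open import Data.Fin.Subset.Properties using (p⊆q⇒∣p∣≤∣q∣; x∈⁅x⁆; ∣⁅x⁆∣≡1; x∈p∪q⁺)
open import Data.Vec using ([]; _∷_; tabulate)
open import Data.Vec.Properties using ([]=⇒lookup; lookup∘tabulate)
open import Data.Bool using (T)
open import Data.Maybe using (Maybe; just; nothing; fromMaybe)
open import Data.List using (List; length; filter; allFin; lookup)
open import Data.List.Properties using (length-tabulate)
open import Data.List.Membership.Propositional using () renaming (_∈_ to _∈ˡ_)
open import Data.List.Membership.Propositional.Properties using (∈-filter⁺; ∈-allFin)
open import Data.List.Relation.Unary.Any using (index)
open import Data.List.Relation.Unary.Any.Properties using (lookup-index)
open import Data.Product using (∃-syntax; _×_; _,_; proj₁; proj₂)
open import Data.Sum using (_⊎_; inj₁; inj₂)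
open import Data.Empty using (⊥; ⊥-elim)
open import Data.Unit using (⊤; tt)
open import Relation.Nullary using (¬_; Dec; yes; no; ¬?; _×-dec_; _⊎-dec_)
open import Relation.Nullary.Decidable using (T?)
open import Level using (0ℓ)
open import Relation.Unary using (Pred; Decidable)
open import Relation.Unary.Properties using (∁?)
open import Relation.Binary.Definitions using (tri<; tri≈; tri>)
open import Relation.Binary.PropositionalEquality

∣p∪q∣≤∣p∣+∣q∣ : ∀ {m} (p q : Subset m) → ∣ p ∪ q ∣ ≤ ∣ p ∣ + ∣ q ∣
∣p∪q∣≤∣p∣+∣q∣ []            []            = z≤n
∣p∪q∣≤∣p∣+∣q∣ (outside ∷ p) (outside ∷ q) = ∣p∪q∣≤∣p∣+∣q∣ p q
∣p∪q∣≤∣p∣+∣q∣ (outside ∷ p) (inside ∷ q)  = ≤-trans (s≤s (∣p∪q∣≤∣p∣+∣q∣ p q)) (≤-reflexive (sym (+-suc _ _)))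
∣p∪q∣≤∣p∣+∣q∣ (inside ∷ p)  (outside ∷ q) = s≤s (∣p∪q∣≤∣p∣+∣q∣ p q)
∣p∪q∣≤∣p∣+∣q∣ (inside ∷ p)  (inside ∷ q)  = s≤s (≤-trans (∣p∪q∣≤∣p∣+∣q∣ p q) (≤-trans (n≤1+n _) (≤-reflexive (sym (+-suc _ _)))))

∣p∣≤2 : ∀ {m} (p : Subset m) (x y : Fin m) → (∀ z → z ∈ p → z ≡ x ⊎ z ≡ y) → ∣ p ∣ ≤ 2
∣p∣≤2 p x y p⊆xy = begin
  ∣ p ∣                 ≤⟨ p⊆q⇒∣p∣≤∣q∣ p⊆⁅x⁆∪⁅y⁆ ⟩
  ∣ ⁅ x ⁆ ∪ ⁅ y ⁆ ∣     ≤⟨ ∣p∪q∣≤∣p∣+∣q∣ ⁅ x ⁆ ⁅ y ⁆ ⟩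
  ∣ ⁅ x ⁆ ∣ + ∣ ⁅ y ⁆ ∣ ≡⟨ cong₂ _+_ (∣⁅x⁆∣≡1 x) (∣⁅x⁆∣≡1 y) ⟩
  2                     ∎
  where
  open ≤-Reasoning
  p⊆⁅x⁆∪⁅y⁆ : p ⊆ ⁅ x ⁆ ∪ ⁅ y ⁆
  p⊆⁅x⁆∪⁅y⁆ {z} z∈p with p⊆xy z z∈p
  ... | inj₁ refl = x∈p∪q⁺ (inj₁ (x∈⁅x⁆ z))
  ... | inj₂ refl = x∈p∪q⁺ (inj₂ (x∈⁅x⁆ z))

length-filter+length-filter-∁ : ∀ {A : Set} {P : Pred A 0ℓ} (P? : Decidable P) (xs : List A) →
  length (filter P? xs) + length (filter (∁? P?) xs) ≡ length xs
length-filter+length-filter-∁ P? Data.List.[] = refl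
length-filter+length-filter-∁ P? (x Data.List.∷ xs) with P? x
... | yes _ = cong suc (length-filter+length-filter-∁ P? xs)
... | no _  = trans (+-suc _ _) (cong suc (length-filter+length-filter-∁ P? xs))

n∸1<[n+1∸k]² : ∀ n k c → 1 ≤ c → k + c ≤ n → k ≤ 2 + c * c → n ∸ 1 < (n + 1 ∸ k) ^ 2
n∸1<[n+1∸k]² n k c 1≤c k+c≤n k≤2+c² = begin-strict
  n ∸ 1               ≡⟨ cong (_∸ 1) (sym k+d≡n) ⟩
  k + d ∸ 1           ≤⟨ ∸-monoˡ-≤ 1 (+-monoˡ-≤ d (≤-trans k≤2+c² (+-monoʳ-≤ 2 (*-mono-≤ c≤d c≤d)))) ⟩
  1 + (d * d + d)     <⟨ +-monoʳ-< 1 (m<m+n (d * d + d) (≤-trans 1≤c c≤d)) ⟩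
  1 + (d * d + d + d) ≡⟨ square-suc d ⟩
  suc d * suc d       ≡⟨ cong (suc d *_) (sym (*-identityʳ (suc d))) ⟩
  suc d ^ 2           ≡⟨ cong (_^ 2) (sym n+1∸k≡1+d) ⟩
  (n + 1 ∸ k) ^ 2     ∎
  where
  open ≤-Reasoning
  d : ℕ
  d = n ∸ k
  k+d≡n : k + d ≡ n
  k+d≡n = m+[n∸m]≡n (≤-trans (m≤m+n k c) k+c≤n)
  c≤d : c ≤ d
  c≤d = +-cancelˡ-≤ k c d (subst (k + c ≤_) (sym k+d≡n) k+c≤n)
  n+1∸k≡1+d : n + 1 ∸ k ≡ suc d
  n+1∸k≡1+d = trans (+-∸-comm 1 (≤-trans (m≤m+n k c) k+c≤n)) (+-comm d 1)
  square-suc : ∀ x → 1 + (x * x + x + x) ≡ suc x * suc x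
  square-suc = solve-∀

m<n⇒m≢n∸1⇒1+m<n : ∀ {m n} → m < n → m ≢ n ∸ 1 → suc m < n
m<n⇒m≢n∸1⇒1+m<n m<n m≢n∸1 = ≤∧≢⇒< m<n (λ 1+m≡n → m≢n∸1 (cong (_∸ 1) 1+m≡n))

m∸n≡1+m∸[1+n] : ∀ {m n} → n < m → m ∸ n ≡ suc (m ∸ suc n)
m∸n≡1+m∸[1+n] {suc m} {zero}  _         = refl
m∸n≡1+m∸[1+n] {suc m} {suc n} (s≤s n<m) = m∸n≡1+m∸[1+n] n<m

Avoids : ∀ {n} → Maybe (Fin n × Fin n) → Fin n → Set
Avoids nothing         x = ⊤
Avoids (just (a , b))  x = x ≢ a × x ≢ b

Avoids-fromMaybe : ∀ {n} (e : Maybe (Fin n × Fin n)) d {x} →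
  x ≢ proj₁ (fromMaybe d e) → x ≢ proj₂ (fromMaybe d e) → Avoids e x
Avoids-fromMaybe nothing       _ _   _   = tt
Avoids-fromMaybe (just _)      _ x≢a x≢b = x≢a , x≢b

Adj : ∀ {n} → SimpleGraph n → Fin n → Fin n → Set
Adj G u v = T (adj G u v)

Adj-sym : ∀ {n} (G : SimpleGraph n) {u v} → Adj G u v → Adj G v u
Adj-sym G {u} {v} = subst T (symm G u v)

degree≥3⇒third-neighbour : ∀ {n} (G : SimpleGraph n) v → 3 ≤ degree G v →
  ∀ u₁ u₂ → ∃[ w ] Adj G v w × w ≢ u₁ × w ≢ u₂
degree≥3⇒third-neighbour G v δ≥3 u₁ u₂
  with any? (λ w → T? (adj G v w) ×-dec ¬? (w ≟ᶠ u₁) ×-dec ¬? (w ≟ᶠ u₂))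
... | yes found = found
... | no none = ⊥-elim (<⇒≱ (s≤s (s≤s (s≤s z≤n))) (≤-trans δ≥3 (∣p∣≤2 _ u₁ u₂ N⊆u₁u₂)))
  where
  N⊆u₁u₂ : ∀ w → w ∈ tabulate (adj G v) → w ≡ u₁ ⊎ w ≡ u₂
  N⊆u₁u₂ w w∈N with w ≟ᶠ u₁ | w ≟ᶠ u₂
  ... | yes w≡u₁ | _        = inj₁ w≡u₁
  ... | no _     | yes w≡u₂ = inj₂ w≡u₂
  ... | no w≢u₁  | no w≢u₂  = ⊥-elim (none (w , v~w , w≢u₁ , w≢u₂))
    where
    v~w : Adj G v w
    v~w = subst T (trans (sym ([]=⇒lookup w∈N)) (lookup∘tabulate (adj G v) w)) _

Joins : ∀ {n} → Fin n → Fin n → Fin n → Fin n → Set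
Joins u v a b = (u ≡ a × v ≡ b) ⊎ (u ≡ b × v ≡ a)

Joins-swap : ∀ {n} {u v a b : Fin n} → Joins u v a b → Joins v u a b
Joins-swap (inj₁ (u≡a , v≡b)) = inj₂ (v≡b , u≡a)
Joins-swap (inj₂ (u≡b , v≡a)) = inj₁ (v≡a , u≡b)

Joins-subst : ∀ {n} {u v u′ v′ a b : Fin n} → u ≡ u′ → v ≡ v′ → Joins u v a b → Joins u′ v′ a b
Joins-subst refl refl j = j

Joins-avoids : ∀ {n} {u v a b x : Fin n} → x ≢ a → x ≢ b → Joins u v a b → u ≢ x
Joins-avoids x≢a x≢b (inj₁ (u≡a , _)) refl = x≢a u≡a
Joins-avoids x≢a x≢b (inj₂ (u≡b , _)) refl = x≢b u≡b

-- A cycle given by an ℕ-indexed vertex sequence; only the indices below size matter.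
record ClosedWalk {n} (G : SimpleGraph n) : Set where
  field
    size     : ℕ
    size≥3   : 3 ≤ size
    at       : ℕ → Fin n
    injective : ∀ i j → i < size → j < size → at i ≡ at j → i ≡ j
    step     : ∀ i → suc i < size → Adj G (at i) (at (suc i))
    closing  : Adj G (at (size ∸ 1)) (at 0)

module _ {n} {G : SimpleGraph n} (W : ClosedWalk G) where
  open ClosedWalk W

  toCycle : Cycle G
  toCycle = record
    { len = size ; len≥3 = size≥3 ; vtx = λ i → at (toℕ i)
    ; distinct = λ {i} {j} eq → toℕ-injective (injective (toℕ i) (toℕ j) (toℕ<n i) (toℕ<n j) eq)
    ; edges = consecutive-adjacent }
    where
    consecutive-adjacent : ∀ i j → Consec i j → Adj G (at (toℕ i)) (at (toℕ j))
    consecutive-adjacent i j (inj₁ i+1≡j) =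
      subst (λ x → Adj G (at (toℕ i)) (at x)) i+1≡j (step (toℕ i) (subst (_< size) (sym i+1≡j) (toℕ<n j)))
    consecutive-adjacent i j (inj₂ (i+1≡size , j≡0)) =
      subst₂ (λ x y → Adj G (at x) (at y)) (cong (_∸ 1) (sym i+1≡size)) (sym j≡0) closing

  toCycle-vertex : ∀ m → m < size → ∃[ i ] vtx toCycle i ≡ at m
  toCycle-vertex m m<size = fromℕ< m<size , cong at (toℕ-fromℕ< m<size)

  toCycle-edge : ∀ {a b} m → suc m < size → Joins (at m) (at (suc m)) a b → CycleEdge toCycle a b
  toCycle-edge m m+1<size ends =
    fromℕ< m<size , fromℕ< m+1<size , inj₁ consec ,
    Joins-subst (cong at (sym ≡m)) (cong at (sym ≡m+1)) ends
    where
    m<size : m < size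
    m<size = <-trans (n<1+n m) m+1<size
    ≡m : toℕ (fromℕ< m<size) ≡ m
    ≡m = toℕ-fromℕ< m<size
    ≡m+1 : toℕ (fromℕ< m+1<size) ≡ suc m
    ≡m+1 = toℕ-fromℕ< m+1<size
    consec : suc (toℕ (fromℕ< m<size)) ≡ toℕ (fromℕ< m+1<size)
    consec = trans (cong suc ≡m) (sym ≡m+1)

module Modulo (k : ℕ) {{_ : NonZero k}} where

  infix 4 _≈_
  _≈_ : ℕ → ℕ → Set
  x ≈ y = x % k ≡ y % k

  ≈-+ʳ : ∀ {x y} z → x ≈ y → x + z ≈ y + z
  ≈-+ʳ {x} {y} z x≈y = begin
    (x + z) % k           ≡⟨ %-distribˡ-+ x z k ⟩
    (x % k + z % k) % k   ≡⟨ cong (λ w → (w + z % k) % k) x≈y ⟩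
    (y % k + z % k) % k   ≡⟨ %-distribˡ-+ y z k ⟨
    (y + z) % k           ∎
    where open ≡-Reasoning

  ≈-+ˡ : ∀ {x y} z → x ≈ y → z + x ≈ z + y
  ≈-+ˡ {x} {y} z x≈y = subst₂ _≈_ (+-comm x z) (+-comm y z) (≈-+ʳ z x≈y)

  x%k≈x : ∀ x → x % k ≈ x
  x%k≈x x = m%n%n≡m%n x k

  x+k≈x : ∀ x → x + k ≈ x
  x+k≈x x = [m+n]%n≡m%n x k

  ≈⇒≡ : ∀ {x y} → x < k → y < k → x ≈ y → x ≡ y
  ≈⇒≡ x<k y<k x≈y = trans (sym (m<n⇒m%n≡m x<k)) (trans x≈y (m<n⇒m%n≡m y<k))

  toℕ-mod : ∀ x → toℕ (x mod k) ≡ x % k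
  toℕ-mod x = toℕ-fromℕ< (m%n<n x k)

  Consec-mod : ∀ x → Consec (x mod k) (suc x mod k)
  Consec-mod x with suc (x % k) <? k
  ... | yes x%k+1<k = inj₁ (begin
    suc (toℕ (x mod k))  ≡⟨ cong suc (toℕ-mod x) ⟩
    suc (x % k)          ≡⟨ m<n⇒m%n≡m x%k+1<k ⟨
    suc (x % k) % k      ≡⟨ ≈-+ˡ 1 (x%k≈x x) ⟩
    suc x % k            ≡⟨ toℕ-mod (suc x) ⟨
    toℕ (suc x mod k)    ∎)
    where open ≡-Reasoning
  ... | no x%k+1≮k = inj₂ (trans (cong suc (toℕ-mod x)) x%k+1≡k , (begin
    toℕ (suc x mod k)  ≡⟨ toℕ-mod (suc x) ⟩
    suc x % k          ≡⟨ ≈-+ˡ 1 (x%k≈x x) ⟨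
    suc (x % k) % k    ≡⟨ cong (_% k) x%k+1≡k ⟩
    k % k              ≡⟨ n%n≡0 k ⟩
    0                  ∎))
    where
    open ≡-Reasoning
    x%k+1≡k : suc (x % k) ≡ k
    x%k+1≡k = ≤-antisym (m%n<n x k) (≮⇒≥ x%k+1≮k)

module ChordlessLongestCycle {n} (G : SimpleGraph n) (δ≥3 : ∀ v → 3 ≤ degree G v)
  (F : LinearForest≤1 G) (C : Cycle G) (C⊇F : Contains C F)
  (C-longest : (D : Cycle G) → Contains D F → len D ≤ len C) (chordless : ¬ HasChord C) where

  infix 4 _~_
  _~_ : Fin n → Fin n → Set
  _~_ = Adj G

  k : ℕ
  k = len C

  1≤k : 1 ≤ k
  1≤k = ≤-trans (s≤s z≤n) (len≥3 C)

  instance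
    k≢0 : NonZero k
    k≢0 = >-nonZero 1≤k

  open Modulo k

  k∸1+1≡k : suc (k ∸ 1) ≡ k
  k∸1+1≡k = trans (+-comm 1 (k ∸ 1)) (m∸n+n≡m 1≤k)

  C[_] : ℕ → Fin n
  C[ x ] = vtx C (x mod k)

  C[]-cong : ∀ {x y} → x ≈ y → C[ x ] ≡ C[ y ]
  C[]-cong {x} {y} x≈y = cong (vtx C) (toℕ-injective (trans (toℕ-mod x) (trans x≈y (sym (toℕ-mod y)))))

  C[]-injective : ∀ {x y} → C[ x ] ≡ C[ y ] → x ≈ y
  C[]-injective {x} {y} eq = trans (sym (toℕ-mod x)) (trans (cong toℕ (distinct C eq)) (toℕ-mod y))

  C[]-injective-< : ∀ {x y} → x < k → y < k → C[ x ] ≡ C[ y ] → x ≡ y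
  C[]-injective-< x<k y<k eq = ≈⇒≡ x<k y<k (C[]-injective eq)

  vtx≡C[toℕ] : ∀ j → vtx C j ≡ C[ toℕ j ]
  vtx≡C[toℕ] j = cong (vtx C) (toℕ-injective (sym (trans (toℕ-mod (toℕ j)) (m<n⇒m%n≡m (toℕ<n j)))))

  C[]-step : ∀ x → C[ x ] ~ C[ suc x ]
  C[]-step x = edges C _ _ (Consec-mod x)

  C[suc]-cong : ∀ {x y} → C[ x ] ≡ C[ y ] → C[ suc x ] ≡ C[ suc y ]
  C[suc]-cong eq = C[]-cong (≈-+ˡ 1 (C[]-injective eq))

  C[x+k]≡C[x] : ∀ x → C[ x + k ] ≡ C[ x ]
  C[x+k]≡C[x] x = C[]-cong (x+k≈x x)

  Consec⇒C[suc] : ∀ {i j : Fin k} → Consec i j → vtx C j ≡ C[ suc (toℕ i) ]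
  Consec⇒C[suc] {i} {j} (inj₁ i+1≡j) = trans (vtx≡C[toℕ] j) (cong C[_] (sym i+1≡j))
  Consec⇒C[suc] {i} {j} (inj₂ (i+1≡k , j≡0)) =
    trans (vtx≡C[toℕ] j) (trans (cong C[_] j≡0) (sym (trans (cong C[_] i+1≡k) (C[x+k]≡C[x] 0))))

  CycleEdge⇒Joins : ∀ {a b} → CycleEdge C a b → ∃[ e ] Joins C[ e ] C[ suc e ] a b
  CycleEdge⇒Joins (i , j , consec , joins) =
    toℕ i , Joins-subst (vtx≡C[toℕ] i) (Consec⇒C[suc] consec) joins

  OffC : Fin n → Set
  OffC w = ∀ j → vtx C j ≢ w

  -- The two cycle neighbours of a vertex are excluded, so a third neighbour
  -- on C would be the far end of a chord.
  off-cycle-neighbour : ∀ i → ∃[ w ] vtx C i ~ w × OffC w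
  off-cycle-neighbour i with degree≥3⇒third-neighbour G (vtx C i) (δ≥3 _) C[ suc (toℕ i) ] C[ toℕ i + (k ∸ 1) ]
  ... | w , i~w , w≢next , w≢prev = w , i~w , off
    where
    off : OffC w
    off j j≡w = chordless (i , j , i≢j , ¬i→j , ¬j→i , i~j)
      where
      i~j : vtx C i ~ vtx C j
      i~j = subst (vtx C i ~_) (sym j≡w) i~w
      i≢j : i ≢ j
      i≢j refl = irrefl G _ i~j
      ¬i→j : ¬ Consec i j
      ¬i→j consec = w≢next (trans (sym j≡w) (Consec⇒C[suc] consec))
      ¬j→i : ¬ Consec j i
      ¬j→i consec = w≢prev (trans (sym j≡w) (trans (vtx≡C[toℕ] j) (C[]-cong j≈i+k∸1)))
        where
        j+1≈i : suc (toℕ j) ≈ toℕ i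
        j+1≈i = C[]-injective (trans (sym (Consec⇒C[suc] consec)) (vtx≡C[toℕ] i))
        j≈i+k∸1 : toℕ j ≈ toℕ i + (k ∸ 1)
        j≈i+k∸1 = trans (sym (x+k≈x (toℕ j)))
          (subst (_≈ toℕ i + (k ∸ 1)) (trans (sym (+-suc (toℕ j) (k ∸ 1))) (cong (toℕ j +_) k∸1+1≡k))
            (≈-+ʳ (k ∸ 1) j+1≈i))

  rotation-surjective : ∀ s x → ∃[ m ] m < k × C[ s + m ] ≡ C[ x ]
  rotation-surjective s x = m , m%n<n (x + (k ∸ s % k)) k , C[]-cong s+m≈x
    where
    m : ℕ
    m = (x + (k ∸ s % k)) % k
    s%k+x+[k∸s%k]≡x+k : s % k + (x + (k ∸ s % k)) ≡ x + k
    s%k+x+[k∸s%k]≡x+k = begin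
      s % k + (x + (k ∸ s % k))  ≡⟨ +-assoc (s % k) x _ ⟨
      s % k + x + (k ∸ s % k)    ≡⟨ cong (_+ (k ∸ s % k)) (+-comm (s % k) x) ⟩
      x + s % k + (k ∸ s % k)    ≡⟨ +-assoc x (s % k) _ ⟩
      x + (s % k + (k ∸ s % k))  ≡⟨ cong (x +_) (m+[n∸m]≡n (<⇒≤ (m%n<n s k))) ⟩
      x + k                      ∎
      where open ≡-Reasoning
    s+m≈x : s + m ≈ x
    s+m≈x = trans (≈-+ˡ s (x%k≈x (x + (k ∸ s % k))))
      (trans (≈-+ʳ (x + (k ∸ s % k)) (sym (x%k≈x s)))
        (subst (_≈ x) (sym s%k+x+[k∸s%k]≡x+k) (x+k≈x x)))

  rotation-injective : ∀ s {m m′} → m < k → m′ < k → C[ s + m ] ≡ C[ s + m′ ] → m ≡ m′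
  rotation-injective s {m} {m′} m<k m′<k eq =
    ≈⇒≡ m<k m′<k (trans (sym (unrotate m)) (trans (≈-+ʳ (k ∸ s % k) (C[]-injective eq)) (unrotate m′)))
    where
    unrotate : ∀ x → s + x + (k ∸ s % k) ≈ x
    unrotate x = subst (_≈ x) (sym (trans (cong (_+ (k ∸ s % k)) (+-comm s x)) (+-assoc x s _)))
      (trans (≈-+ˡ x (≈-+ʳ (k ∸ s % k) (sym (x%k≈x s))))
        (subst (λ z → x + z ≈ x) (sym (m+[n∸m]≡n (<⇒≤ (m%n<n s k)))) (x+k≈x x)))

  module Detour (t t′ : ℕ) (t<k : t < k) (t′<k : t′ < k) (t≢t′ : t ≢ t′) {h h′ : Fin n}
    (C[t]~h : C[ t ] ~ h) (C[t′]~h : C[ t′ ] ~ h) (C[t+1]~h′ : C[ suc t ] ~ h′) (C[t′+1]~h′ : C[ suc t′ ] ~ h′)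
    (h-off : OffC h) (h′-off : OffC h′)
    (t-avoids : Avoids (edge F) C[ t ]) (t′-avoids : Avoids (edge F) C[ t′ ]) where

    -- C read from position t + 1, so that the edge C[ t ] C[ t + 1 ] closes it up.
    R[_] : ℕ → Fin n
    R[ m ] = C[ suc t + m ]

    R-step : ∀ m → R[ m ] ~ R[ suc m ]
    R-step m = subst (λ x → R[ m ] ~ C[ x ]) (sym (+-suc (suc t) m)) (C[]-step (suc t + m))

    R[0]≡C[t+1] : R[ 0 ] ≡ C[ suc t ]
    R[0]≡C[t+1] = cong C[_] (+-identityʳ (suc t))

    R[k∸1]≡C[t] : R[ k ∸ 1 ] ≡ C[ t ]
    R[k∸1]≡C[t] = trans (cong C[_] (trans (sym (+-suc t (k ∸ 1))) (cong (t +_) k∸1+1≡k))) (C[x+k]≡C[x] t)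

    R[suc]-cong : ∀ {m x} → R[ m ] ≡ C[ x ] → R[ suc m ] ≡ C[ suc x ]
    R[suc]-cong {m} eq = trans (cong C[_] (+-suc (suc t) m)) (C[suc]-cong eq)

    R-injective : ∀ {m m′} → m < k → m′ < k → R[ m ] ≡ R[ m′ ] → m ≡ m′
    R-injective = rotation-injective (suc t)

    R-off : ∀ m {w} → OffC w → R[ m ] ≢ w
    R-off m w-off = w-off ((suc t + m) mod k)

    p : ℕ
    p = proj₁ (rotation-surjective (suc t) t′)

    p<k : p < k
    p<k = proj₁ (proj₂ (rotation-surjective (suc t) t′))

    R[p]≡C[t′] : R[ p ] ≡ C[ t′ ]
    R[p]≡C[t′] = proj₂ (proj₂ (rotation-surjective (suc t) t′))

    p+1<k : suc p < k
    p+1<k = m<n⇒m≢n∸1⇒1+m<n p<k λ p≡k∸1 →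
      t≢t′ (C[]-injective-< t<k t′<k (trans (sym R[k∸1]≡C[t]) (trans (cong R[_] (sym p≡k∸1)) R[p]≡C[t′])))

    Covers : ClosedWalk G → Set
    Covers W = ∀ m → m < k → ∃[ i ] i < ClosedWalk.size W × ClosedWalk.at W i ≡ R[ m ]

    KeepsEdges : ClosedWalk G → Set
    KeepsEdges W = ∀ {a b} m → suc m < k → R[ m ] ≢ C[ t′ ] →
      Joins R[ m ] R[ suc m ] a b → CycleEdge (toCycle W) a b

    toCycle-contains-F : (W : ClosedWalk G) → Covers W → KeepsEdges W → Contains (toCycle W) F
    toCycle-contains-F W covers keeps = vertices , edge-kept (edge F) t-avoids t′-avoids (proj₂ C⊇F)
      where
      vertices : ∀ v → v ∈ verts F → ∃[ i ] vtx (toCycle W) i ≡ v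
      vertices v v∈F with proj₁ C⊇F v v∈F
      ... | j , j≡v with rotation-surjective (suc t) (toℕ j)
      ... | m , m<k , R[m]≡ with covers m m<k
      ... | i , i<size , at-i≡ with toCycle-vertex W i i<size
      ... | i′ , i′≡ = i′ , trans i′≡ (trans at-i≡ (trans R[m]≡ (trans (sym (vtx≡C[toℕ] j)) j≡v)))
      edge-kept : ∀ e → Avoids e C[ t ] → Avoids e C[ t′ ] → EdgeOnCycle C e → EdgeOnCycle (toCycle W) e
      edge-kept nothing _ _ _ = tt
      edge-kept (just (a , b)) (t≢a , t≢b) (t′≢a , t′≢b) ab∈C with CycleEdge⇒Joins ab∈C
      ... | e , joins with rotation-surjective (suc t) e
      ... | m , m<k , R[m]≡C[e] =
        keeps m (m<n⇒m≢n∸1⇒1+m<n m<k m≢k∸1) (Joins-avoids t′≢a t′≢b joins′) joins′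
        where
        joins′ : Joins R[ m ] R[ suc m ] a b
        joins′ = Joins-subst (sym R[m]≡C[e]) (sym (R[suc]-cong R[m]≡C[e])) joins
        m≢k∸1 : m ≢ k ∸ 1
        m≢k∸1 refl = Joins-avoids t≢a t≢b joins′ R[k∸1]≡C[t]

    no-longer-walk : (W : ClosedWalk G) → k < ClosedWalk.size W → Covers W → KeepsEdges W → ⊥
    no-longer-walk W k<size covers keeps = <⇒≱ k<size (C-longest (toCycle W) (toCycle-contains-F W covers keeps))

    module Insertion (h≡h′ : h ≡ h′) where

      data Segment (i : ℕ) : Set where
        on-C : i < k → Segment i
        at-h : k ≤ i → Segment i

      segment : ∀ i → Segment i
      segment i with i <? k
      ... | yes i<k = on-C i<k
      ... | no i≮k  = at-h (≮⇒≥ i≮k)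

      vertexAt : ∀ {i} → Segment i → Fin n
      vertexAt {i} (on-C _) = R[ i ]
      vertexAt     (at-h _) = h

      vertexAt-irrelevant : ∀ {i} (s s′ : Segment i) → vertexAt s ≡ vertexAt s′
      vertexAt-irrelevant (on-C _)   (on-C _)   = refl
      vertexAt-irrelevant (on-C i<k) (at-h k≤i) = ⊥-elim (<⇒≱ i<k k≤i)
      vertexAt-irrelevant (at-h k≤i) (on-C i<k) = ⊥-elim (<⇒≱ i<k k≤i)
      vertexAt-irrelevant (at-h _)   (at-h _)   = refl

      inserted : ℕ → Fin n
      inserted i = vertexAt (segment i)

      inserted-≡ : ∀ {i} (s : Segment i) → inserted i ≡ vertexAt s
      inserted-≡ {i} = vertexAt-irrelevant (segment i)

      vertexAt-injective : ∀ {i j} (s : Segment i) (s′ : Segment j) → i < suc k → j < suc k →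
        vertexAt s ≡ vertexAt s′ → i ≡ j
      vertexAt-injective (on-C i<k) (on-C j<k) _ _ eq = R-injective i<k j<k eq
      vertexAt-injective (on-C _)   (at-h _)   _ _ eq = ⊥-elim (R-off _ h-off eq)
      vertexAt-injective (at-h _)   (on-C _)   _ _ eq = ⊥-elim (R-off _ h-off (sym eq))
      vertexAt-injective (at-h k≤i) (at-h k≤j) (s≤s i≤k) (s≤s j≤k) _ =
        trans (≤-antisym i≤k k≤i) (≤-antisym k≤j j≤k)

      vertexAt-step : ∀ {i} (s : Segment i) (s′ : Segment (suc i)) → suc i < suc k →
        vertexAt s ~ vertexAt s′
      vertexAt-step (on-C _)   (on-C _)   _ = R-step _
      vertexAt-step {i} (on-C _) (at-h k≤1+i) (s≤s i<k) =
        subst (_~ h) (trans (sym R[k∸1]≡C[t]) (cong R[_] (sym i≡k∸1))) C[t]~h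
        where
        i≡k∸1 : i ≡ k ∸ 1
        i≡k∸1 = cong (_∸ 1) (≤-antisym i<k k≤1+i)
      vertexAt-step (at-h k≤i) _ (s≤s i<k) = ⊥-elim (<⇒≱ i<k k≤i)

      walk : ClosedWalk G
      walk = record
        { size = suc k ; size≥3 = ≤-trans (len≥3 C) (n≤1+n k) ; at = inserted
        ; injective = λ i j → vertexAt-injective (segment i) (segment j)
        ; step = λ i → vertexAt-step (segment i) (segment (suc i))
        ; closing = subst₂ _~_ (sym (inserted-≡ (at-h ≤-refl))) (sym (inserted-≡ (on-C 1≤k)))
            (Adj-sym G (subst₂ _~_ (sym R[0]≡C[t+1]) (sym h≡h′) C[t+1]~h′)) }

      covers : Covers walk
      covers m m<k = m , m<n⇒m<1+n m<k , inserted-≡ (on-C m<k)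

      keeps : KeepsEdges walk
      keeps m m+1<k _ joins = toCycle-edge walk m (m<n⇒m<1+n m+1<k)
        (Joins-subst (sym (inserted-≡ (on-C (<-trans (n<1+n m) m+1<k)))) (sym (inserted-≡ (on-C m+1<k))) joins)

      impossible : ⊥
      impossible = no-longer-walk walk ≤-refl covers keeps

    -- The longer cycle C[t′] … C[t+1] h′ C[t′+1] … C[t] h, read in R-coordinates.
    module Rerouting (h≢h′ : h ≢ h′) where

      data Segment (i : ℕ) : Set where
        back   : i ≤ p → Segment i
        bridge : i ≡ suc p → Segment i
        forth  : suc p < i → i ≤ k → Segment i
        close  : k < i → Segment i

      segment : ∀ i → Segment i
      segment i with i ≤? p | i ≟ suc p | i ≤? k
      ... | yes i≤p | _         | _       = back i≤p
      ... | no _    | yes i≡p+1 | _       = bridge i≡p+1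
      ... | no i≰p  | no i≢p+1  | yes i≤k = forth (≤∧≢⇒< (≰⇒> i≰p) (λ p+1≡i → i≢p+1 (sym p+1≡i))) i≤k
      ... | no _    | no _      | no i≰k  = close (≰⇒> i≰k)

      vertexAt : ∀ {i} → Segment i → Fin n
      vertexAt {i} (back _)    = R[ p ∸ i ]
      vertexAt     (bridge _)  = h′
      vertexAt {i} (forth _ _) = R[ i ∸ 1 ]
      vertexAt     (close _)   = h

      k<i⇒p+1<i : ∀ {i} → k < i → suc p < i
      k<i⇒p+1<i k<i = <-trans p+1<k k<i

      vertexAt-irrelevant : ∀ {i} (s s′ : Segment i) → vertexAt s ≡ vertexAt s′
      vertexAt-irrelevant (back _)      (back _)      = refl
      vertexAt-irrelevant (back i≤p)    (bridge refl) = ⊥-elim (1+n≰n i≤p)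
      vertexAt-irrelevant (back i≤p)    (forth p<i _) = ⊥-elim (<⇒≱ p<i (m≤n⇒m≤1+n i≤p))
      vertexAt-irrelevant (back i≤p)    (close k<i)   = ⊥-elim (<⇒≱ (k<i⇒p+1<i k<i) (m≤n⇒m≤1+n i≤p))
      vertexAt-irrelevant (bridge refl) (back i≤p)    = ⊥-elim (1+n≰n i≤p)
      vertexAt-irrelevant (bridge _)    (bridge _)    = refl
      vertexAt-irrelevant (bridge refl) (forth p<i _) = ⊥-elim (<-irrefl refl p<i)
      vertexAt-irrelevant (bridge refl) (close k<i)   = ⊥-elim (<-irrefl refl (k<i⇒p+1<i k<i))
      vertexAt-irrelevant (forth p<i _) (back i≤p)    = ⊥-elim (<⇒≱ p<i (m≤n⇒m≤1+n i≤p))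
      vertexAt-irrelevant (forth p<i _) (bridge refl) = ⊥-elim (<-irrefl refl p<i)
      vertexAt-irrelevant (forth _ _)   (forth _ _)   = refl
      vertexAt-irrelevant (forth _ i≤k) (close k<i)   = ⊥-elim (<⇒≱ k<i i≤k)
      vertexAt-irrelevant (close k<i)   (back i≤p)    = ⊥-elim (<⇒≱ (k<i⇒p+1<i k<i) (m≤n⇒m≤1+n i≤p))
      vertexAt-irrelevant (close k<i)   (bridge refl) = ⊥-elim (<-irrefl refl (k<i⇒p+1<i k<i))
      vertexAt-irrelevant (close k<i)   (forth _ i≤k) = ⊥-elim (<⇒≱ k<i i≤k)
      vertexAt-irrelevant (close _)     (close _)     = refl

      rerouted : ℕ → Fin n
      rerouted i = vertexAt (segment i)

      rerouted-≡ : ∀ {i} (s : Segment i) → rerouted i ≡ vertexAt s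
      rerouted-≡ {i} = vertexAt-irrelevant (segment i)

      p∸i<k : ∀ i → p ∸ i < k
      p∸i<k i = ≤-<-trans (m∸n≤m p i) p<k

      i∸1<k : ∀ {i} → suc p < i → i ≤ k → i ∸ 1 < k
      i∸1<k {suc i} _ i<k = i<k

      1≤i : ∀ {i} → suc p < i → 1 ≤ i
      1≤i k<i⇒p+1<i = ≤-trans (s≤s z≤n) k<i⇒p+1<i

      R-back≢R-forth : ∀ i {j} → suc p < j → j ≤ k → R[ p ∸ i ] ≢ R[ j ∸ 1 ]
      R-back≢R-forth i {suc j} (s≤s p<j) j<k eq =
        <⇒≢ (≤-<-trans (m∸n≤m p i) p<j) (R-injective (p∸i<k i) j<k eq)

      vertexAt-injective : ∀ {i j} (s : Segment i) (s′ : Segment j) → i < 2 + k → j < 2 + k →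
        vertexAt s ≡ vertexAt s′ → i ≡ j
      vertexAt-injective {i} {j} (back i≤p) (back j≤p) _ _ eq =
        ∸-cancelˡ-≡ i≤p j≤p (R-injective (p∸i<k i) (p∸i<k j) eq)
      vertexAt-injective (back _)        (bridge _)      _ _ eq = ⊥-elim (R-off _ h′-off eq)
      vertexAt-injective {i} (back _) (forth p<j j≤k) _ _ eq = ⊥-elim (R-back≢R-forth i p<j j≤k eq)
      vertexAt-injective (back _)        (close _)       _ _ eq = ⊥-elim (R-off _ h-off eq)
      vertexAt-injective (bridge _)      (back _)        _ _ eq = ⊥-elim (R-off _ h′-off (sym eq))
      vertexAt-injective (bridge i≡)     (bridge j≡)     _ _ _  = trans i≡ (sym j≡)
      vertexAt-injective (bridge _)      (forth _ _)     _ _ eq = ⊥-elim (R-off _ h′-off (sym eq))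
      vertexAt-injective (bridge _)      (close _)       _ _ eq = ⊥-elim (h≢h′ (sym eq))
      vertexAt-injective {j = j} (forth p<i i≤k) (back _) _ _ eq = ⊥-elim (R-back≢R-forth j p<i i≤k (sym eq))
      vertexAt-injective (forth _ _)     (bridge _)      _ _ eq = ⊥-elim (R-off _ h′-off eq)
      vertexAt-injective (forth p<i i≤k) (forth p<j j≤k) _ _ eq =
        ∸-cancelʳ-≡ (1≤i p<i) (1≤i p<j) (R-injective (i∸1<k p<i i≤k) (i∸1<k p<j j≤k) eq)
      vertexAt-injective (forth _ _)     (close _)       _ _ eq = ⊥-elim (R-off _ h-off eq)
      vertexAt-injective (close _)       (back _)        _ _ eq = ⊥-elim (R-off _ h-off (sym eq))
      vertexAt-injective (close _)       (bridge _)      _ _ eq = ⊥-elim (h≢h′ eq)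
      vertexAt-injective (close _)       (forth _ _)     _ _ eq = ⊥-elim (R-off _ h-off (sym eq))
      vertexAt-injective (close k<i)     (close k<j)     (s≤s i≤k+1) (s≤s j≤k+1) _ =
        trans (≤-antisym i≤k+1 k<i) (≤-antisym k<j j≤k+1)

      vertexAt-step : ∀ {i} (s : Segment i) (s′ : Segment (suc i)) → suc i < 2 + k →
        vertexAt s ~ vertexAt s′
      vertexAt-step {i} (back _) (back 1+i≤p) _ =
        subst (λ x → R[ x ] ~ R[ p ∸ suc i ]) (sym (m∸n≡1+m∸[1+n] {p} {i} 1+i≤p)) (Adj-sym G (R-step (p ∸ suc i)))
      vertexAt-step {i} (back _) (bridge 1+i≡1+p) _ =
        subst (_~ h′) (sym (trans (cong R[_] p∸i≡0) R[0]≡C[t+1])) C[t+1]~h′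
        where
        p∸i≡0 : p ∸ i ≡ 0
        p∸i≡0 = trans (cong (p ∸_) (suc-injective 1+i≡1+p)) (n∸n≡0 p)
      vertexAt-step (back i≤p)    (forth p+1<1+i _) _ = ⊥-elim (<⇒≱ (s≤s⁻¹ p+1<1+i) i≤p)
      vertexAt-step (back i≤p)    (close k<1+i)     _ = ⊥-elim (<⇒≱ (≤-<-trans i≤p p<k) (s≤s⁻¹ k<1+i))
      vertexAt-step (bridge refl) (back 1+i≤p)      _ = ⊥-elim (1+n≰n (≤-trans (n≤1+n _) 1+i≤p))
      vertexAt-step (bridge refl) (bridge 1+i≡1+p)  _ = ⊥-elim (1+n≢n 1+i≡1+p)
      vertexAt-step (bridge refl) (forth _ _)       _ =
        subst (h′ ~_) (sym (R[suc]-cong R[p]≡C[t′])) (Adj-sym G C[t′+1]~h′)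
      vertexAt-step (bridge refl) (close k<1+i)     _ = ⊥-elim (<⇒≱ p+1<k (s≤s⁻¹ k<1+i))
      vertexAt-step (forth k<i⇒p+1<i _) (back 1+i≤p)     _ = ⊥-elim (<⇒≱ k<i⇒p+1<i (m≤n⇒m≤1+n (<⇒≤ 1+i≤p)))
      vertexAt-step (forth k<i⇒p+1<i _) (bridge 1+i≡1+p) _ = ⊥-elim (<⇒≱ k<i⇒p+1<i (m≤n⇒m≤1+n (≤-reflexive (suc-injective 1+i≡1+p))))
      vertexAt-step {suc i} (forth _ _) (forth _ _)  _ = R-step i
      vertexAt-step {i} (forth _ i≤k) (close k<1+i)  _ =
        subst (_~ h) (sym (trans (cong (λ x → R[ x ∸ 1 ]) (≤-antisym i≤k (s≤s⁻¹ k<1+i))) R[k∸1]≡C[t])) C[t]~h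
      vertexAt-step (close k<i) _ (s≤s (s≤s i≤k)) = ⊥-elim (<⇒≱ k<i i≤k)

      walk : ClosedWalk G
      walk = record
        { size = 2 + k ; size≥3 = ≤-trans (len≥3 C) (m≤n+m k 2) ; at = rerouted
        ; injective = λ i j → vertexAt-injective (segment i) (segment j)
        ; step = λ i → vertexAt-step (segment i) (segment (suc i))
        ; closing = subst₂ _~_ (sym (rerouted-≡ (close ≤-refl))) (sym (trans (rerouted-≡ (back z≤n)) R[p]≡C[t′]))
            (Adj-sym G C[t′]~h) }

      covers : Covers walk
      covers m m<k with m ≤? p
      ... | yes m≤p = p ∸ m , m<n⇒m<1+n (m<n⇒m<1+n (p∸i<k m)) ,
                      trans (rerouted-≡ (back (m∸n≤m p m))) (cong R[_] (m∸[m∸n]≡n m≤p))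
      ... | no m≰p  = suc m , s≤s (m<n⇒m<1+n m<k) , rerouted-≡ (forth (s≤s (≰⇒> m≰p)) m<k)

      keeps : KeepsEdges walk
      keeps m m+1<k R[m]≢C[t′] joins with <-cmp m p
      ... | tri≈ _ m≡p _ = ⊥-elim (R[m]≢C[t′] (trans (cong R[_] m≡p) R[p]≡C[t′]))
      ... | tri< m<p _ _ =
        toCycle-edge walk (p ∸ suc m) (m<n⇒m<1+n (m<n⇒m<1+n (subst (_< k) (sym 1+p∸[1+m]≡p∸m) (p∸i<k m))))
          (Joins-subst (sym at-i) (sym at-i+1) (Joins-swap joins))
        where
        1+p∸[1+m]≡p∸m : suc (p ∸ suc m) ≡ p ∸ m
        1+p∸[1+m]≡p∸m = sym (m∸n≡1+m∸[1+n] m<p)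
        at-i : rerouted (p ∸ suc m) ≡ R[ suc m ]
        at-i = trans (rerouted-≡ (back (m∸n≤m p (suc m)))) (cong R[_] (m∸[m∸n]≡n m<p))
        at-i+1 : rerouted (suc (p ∸ suc m)) ≡ R[ m ]
        at-i+1 = trans (cong rerouted 1+p∸[1+m]≡p∸m)
          (trans (rerouted-≡ (back (m∸n≤m p m))) (cong R[_] (m∸[m∸n]≡n (<⇒≤ m<p))))
      ... | tri> _ _ p<m =
        toCycle-edge walk (suc m) (s≤s (s≤s (<⇒≤ m+1<k)))
          (Joins-subst (sym (rerouted-≡ (forth (s≤s p<m) (<⇒≤ m+1<k))))
                       (sym (rerouted-≡ (forth (s≤s (m≤n⇒m≤1+n p<m)) m+1<k))) joins)

      impossible : ⊥
      impossible = no-longer-walk walk (m<n⇒m<1+n ≤-refl) covers keeps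

  abstract
    outer : ℕ → Fin n
    outer x = proj₁ (off-cycle-neighbour (x mod k))

    C[]~outer : ∀ x → C[ x ] ~ outer x
    C[]~outer x = proj₁ (proj₂ (off-cycle-neighbour (x mod k)))

    outer-off : ∀ x → OffC (outer x)
    outer-off x = proj₂ (proj₂ (off-cycle-neighbour (x mod k)))

  outer-pairs-differ : ∀ {t t′} → t < k → t′ < k → t ≢ t′ →
    Avoids (edge F) C[ t ] → Avoids (edge F) C[ t′ ] →
    outer t ≡ outer t′ → outer (suc t) ≡ outer (suc t′) → ⊥
  outer-pairs-differ {t} {t′} t<k t′<k t≢t′ t-avoids t′-avoids same same′ =
    by-cases (outer t ≟ᶠ outer (suc t))
    where
    open Detour t t′ t<k t′<k t≢t′ (C[]~outer t) (subst (C[ t′ ] ~_) (sym same) (C[]~outer t′))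
      (C[]~outer (suc t)) (subst (C[ suc t′ ] ~_) (sym same′) (C[]~outer (suc t′)))
      (outer-off t) (outer-off (suc t)) t-avoids t′-avoids
    by-cases : Dec (outer t ≡ outer (suc t)) → ⊥
    by-cases (yes h≡h′) = Insertion.impossible h≡h′
    by-cases (no h≢h′)  = Rerouting.impossible h≢h′

  on-C? : ∀ w → Dec (∃[ j ] vtx C j ≡ w)
  on-C? w = any? (λ j → vtx C j ≟ᶠ w)

  outside-C : List (Fin n)
  outside-C = filter (∁? on-C?) (allFin n)

  c : ℕ
  c = length outside-C

  ∈-outside-C : ∀ {w} → OffC w → w ∈ˡ outside-C
  ∈-outside-C {w} w-off = ∈-filter⁺ (∁? on-C?) (∈-allFin w) (λ (j , j≡w) → w-off j j≡w)

  index-off : ∀ {w} → OffC w → Fin c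
  index-off w-off = index (∈-outside-C w-off)

  index-off-injective : ∀ {w w′} (w-off : OffC w) (w′-off : OffC w′) → index-off w-off ≡ index-off w′-off → w ≡ w′
  index-off-injective w-off w′-off eq =
    trans (lookup-index (∈-outside-C w-off)) (trans (cong (lookup outside-C) eq) (sym (lookup-index (∈-outside-C w′-off))))

  1≤c : 1 ≤ c
  1≤c = >-nonZero⁻¹ c {{nonZeroIndex (index-off (outer-off 0))}}

  k+c≤n : k + c ≤ n
  k+c≤n = begin
    k + c                              ≤⟨ +-monoˡ-≤ c (injective⇒≤ (λ {i} {j} → position-injective i j)) ⟩
    length (filter on-C? (allFin n)) + c  ≡⟨ length-filter+length-filter-∁ on-C? (allFin n) ⟩
    length (allFin n)                  ≡⟨ length-tabulate (λ x → x) ⟩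
    n                                  ∎
    where
    open ≤-Reasoning
    ∈-on-C : ∀ j → vtx C j ∈ˡ filter on-C? (allFin n)
    ∈-on-C j = ∈-filter⁺ on-C? (∈-allFin (vtx C j)) (j , refl)
    position-injective : ∀ i j → index (∈-on-C i) ≡ index (∈-on-C j) → i ≡ j
    position-injective i j eq = distinct C
      (trans (lookup-index (∈-on-C i)) (trans (cong (lookup (filter on-C? (allFin n))) eq) (sym (lookup-index (∈-on-C j)))))

  a b : Fin n
  a = proj₁ (fromMaybe (C[ 0 ] , C[ 0 ]) (edge F))
  b = proj₂ (fromMaybe (C[ 0 ] , C[ 0 ]) (edge F))

  -- The (at most two) positions of the ends a, b of the edge of F get their own
  -- codes; every other position t is coded by the pair (outer t , outer (t + 1)).
  -- If F has no edge, a = b = C[ 0 ] is a dummy that merely wastes a code.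
  code′ : ∀ (j : Fin k) → Dec (C[ toℕ j ] ≡ a) → Dec (C[ toℕ j ] ≡ b) → Fin (2 + c * c)
  code′ j (yes _) _       = fzero
  code′ j (no _)  (yes _) = fsuc fzero
  code′ j (no _)  (no _)  = fsuc (fsuc (combine (index-off (outer-off (toℕ j))) (index-off (outer-off (suc (toℕ j))))))

  code : Fin k → Fin (2 + c * c)
  code j = code′ j (C[ toℕ j ] ≟ᶠ a) (C[ toℕ j ] ≟ᶠ b)

  code′-injective : ∀ i j d₁ d₂ d₁′ d₂′ → code′ i d₁ d₂ ≡ code′ j d₁′ d₂′ → i ≡ j
  code′-injective i j (yes i≡a) _ (yes j≡a) _ _ = toℕ-injective (C[]-injective-< (toℕ<n i) (toℕ<n j) (trans i≡a (sym j≡a)))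
  code′-injective i j (yes _) _ (no _) (yes _) ()
  code′-injective i j (yes _) _ (no _) (no _)  ()
  code′-injective i j (no _) (yes _) (yes _) _ ()
  code′-injective i j (no _) (yes i≡b) (no _) (yes j≡b) _ =
    toℕ-injective (C[]-injective-< (toℕ<n i) (toℕ<n j) (trans i≡b (sym j≡b)))
  code′-injective i j (no _) (yes _) (no _) (no _) ()
  code′-injective i j (no _) (no _) (yes _) _ ()
  code′-injective i j (no _) (no _) (no _) (yes _) ()
  code′-injective i j (no i≢a) (no i≢b) (no j≢a) (no j≢b) eq with i ≟ᶠ j
  ... | yes i≡j = i≡j
  ... | no i≢j = ⊥-elim (outer-pairs-differ (toℕ<n i) (toℕ<n j) (λ eq′ → i≢j (toℕ-injective eq′))
        (Avoids-fromMaybe (edge F) _ i≢a i≢b) (Avoids-fromMaybe (edge F) _ j≢a j≢b)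
        (index-off-injective _ _ (proj₁ same-pair)) (index-off-injective _ _ (proj₂ same-pair)))
    where
    same-pair : index-off (outer-off (toℕ i)) ≡ index-off (outer-off (toℕ j))
              × index-off (outer-off (suc (toℕ i))) ≡ index-off (outer-off (suc (toℕ j)))
    same-pair = combine-injective _ _ _ _ (fsuc-injective (fsuc-injective eq))

  k≤2+c² : k ≤ 2 + c * c
  k≤2+c² = injective⇒≤ (λ {i} {j} → code′-injective i j (C[ toℕ i ] ≟ᶠ a) (C[ toℕ i ] ≟ᶠ b) (C[ toℕ j ] ≟ᶠ a) (C[ toℕ j ] ≟ᶠ b))

  circumference-bound : n ∸ 1 < (n + 1 ∸ len C) ^ 2
  circumference-bound = n∸1<[n+1∸k]² n k c 1≤c k+c≤n k≤2+c²

Consec? : ∀ {k} (i j : Fin k) → Dec (Consec i j)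
Consec? {k} i j = (suc (toℕ i) ≟ toℕ j) ⊎-dec ((suc (toℕ i) ≟ k) ×-dec (toℕ j ≟ 0))

HasChord? : ∀ {n} {G : SimpleGraph n} (C : Cycle G) → Dec (HasChord C)
HasChord? {G = G} C = any? λ i → any? λ j →
  ¬? (i ≟ᶠ j) ×-dec ¬? (Consec? i j) ×-dec ¬? (Consec? j i) ×-dec T? (adj G (vtx C i) (vtx C j))

theorem1p10 : (n : ℕ) (G : SimpleGraph n) → (∀ v → 3 ≤ degree G v)
    → (F : LinearForest≤1 G)
    → (∃[ L ] IsLongestContaining F L × ((n + 1 ∸ len L) ^ 2 ≤ n ∸ 1))
    → (C : Cycle G) → IsLongestContaining F C → HasChord C
theorem1p10 n G δ≥3 F (L , (L⊇F , L-longest) , bound) C (C⊇F , C-longest) with HasChord? C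
... | yes chord     = chord
... | no chordless  = ⊥-elim (<⇒≱ (circumference-bound G δ≥3 F C C⊇F C-longest chordless) bound′)
  where
  open ChordlessLongestCycle using (circumference-bound)
  bound′ : (n + 1 ∸ len C) ^ 2 ≤ n ∸ 1
  bound′ = subst (λ l → (n + 1 ∸ l) ^ 2 ≤ n ∸ 1) (≤-antisym (C-longest L L⊇F) (L-longest C C⊇F)) bound
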